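{- Let $(a_n)_{n\ge 0}$, $(b_n)_{n\ge 0}$, $(c_n)_{n\ge 0}$ be sequences of complex numbers with $b_0=1$, $a_n\ne 0$ and $c_n\ne 0$ for all $n\ge 0$. Let $\mathscr{A}$ be the infinite lower triangular matrix with entries $\mathscr{A}_{n,k}=a_kb_{n-k}c_n$ for $n\ge k\ge 0$ (and $0$ for $k>n$). Then the matrix inverse $\mathscr{A}^{ -1}$ belongs to $SDR_\infty$.
   Context: All matrices are infinite lower triangular matrices $\mathscr{A}=(A_{n,k})_{n\ge k\ge 0}$ with complex entries; we set $A_{n,k}=0$ whenever $k>n$. For an integer $m\ge 3$, $\mathscr{A}$ is called an SDR-matrix of order $m$ (written $\mathscr{A}\in SDR_m$) if for all integers $n,k\ge 0$, all $2\le p\le m-1$ and all $0\le r\le p-1$, $$\prod_{i=0}^{r}A_{n+i,k+r-i}\prod_{i=0}^{p-r-1}A_{n+p-i,k+r+i+1}=\prod_{i=0}^{r}A_{n+p-i,k+p-r+i}\prod_{i=0}^{p-r-1}A_{n+i,k+p-r-i-1}.$$ $SDR_\infty$ denotes the set of matrices lying in $SDR_m$ for every $m\ge 3$. -}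

module Defs where

open import Level using (Level; _⊔_) renaming (suc to lsuc)
open import Algebra.Bundles using (CommutativeRing)
open import Data.Nat using (ℕ; zero; suc; _+_; _∸_; _≤_; _<_; _≤ᵇ_; _≡ᵇ_)
open import Data.Bool using (if_then_else_)
open import Data.Product using (∃; _×_)
open import Relation.Nullary using (¬_)

record Field (c ℓ : Level) : Set (lsuc (c ⊔ ℓ)) where
  field
    commutativeRing : CommutativeRing c ℓ
  open CommutativeRing commutativeRing public
  field
    1≉0 : ¬ (1# ≈ 0#)
    inverse : ∀ x → ¬ (x ≈ 0#) → ∃ λ y → (x * y) ≈ 1#

module _ {c ℓ : Level} (F : Field c ℓ) where
  open Field F renaming (_+_ to _⊕_; _*_ to _⊛_)

  -- infinite matrices, indexed (row, column)
  Matrix : Set c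
  Matrix = ℕ → ℕ → Carrier

  prodUpTo : ℕ → (ℕ → Carrier) → Carrier
  prodUpTo zero    f = 1#
  prodUpTo (suc m) f = prodUpTo m f ⊛ f m

  sumUpTo : ℕ → (ℕ → Carrier) → Carrier
  sumUpTo zero    f = 0#
  sumUpTo (suc m) f = sumUpTo m f ⊕ f m

  LowerTriangular : Matrix → Set ℓ
  LowerTriangular M = ∀ n k → n < k → M n k ≈ 0#

  -- product of two lower triangular matrices:
  -- (M N)_{n,k} = Σ_{j=0}^{n} M_{n,j} N_{j,k}  (all other terms vanish)
  mulLT : Matrix → Matrix → Matrix
  mulLT M N n k = sumUpTo (suc n) (λ j → M n j ⊛ N j k)

  identityMatrix : Matrix
  identityMatrix n k = if n ≡ᵇ k then 1# else 0#

  IsInverseLT : Matrix → Matrix → Set ℓ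
  IsInverseLT M N = LowerTriangular N
                  × (∀ n k → mulLT M N n k ≈ identityMatrix n k)
                  × (∀ n k → mulLT N M n k ≈ identityMatrix n k)

  SDR : ℕ → Matrix → Set ℓ
  SDR m A = ∀ n k p r → 2 ≤ p → p ≤ m ∸ 1 → r ≤ p ∸ 1 →
      (prodUpTo (suc r) (λ i → A (n + i) (k + r ∸ i))
        ⊛ prodUpTo (p ∸ r) (λ i → A (n + p ∸ i) (k + r + i + 1)))
    ≈ (prodUpTo (suc r) (λ i → A (n + p ∸ i) (k + (p ∸ r) + i))
        ⊛ prodUpTo (p ∸ r) (λ i → A (n + i) (k + (p ∸ r) ∸ i ∸ 1)))

  SDR∞ : Matrix → Set ℓ
  SDR∞ A = ∀ m → 3 ≤ m → SDR m A

  abcMatrix : (ℕ → Carrier) → (ℕ → Carrier) → (ℕ → Carrier) → Matrix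
  abcMatrix a b c n k = if k ≤ᵇ n then a k ⊛ b (n ∸ k) ⊛ c n else 0#

-- Writing Λ(a) for the diagonal matrix of a sequence a and T(b) for the lower
-- triangular Toeplitz matrix of b, the matrix is Λ(c) T(b) Λ(a). Its inverse
-- is Λ(a)⁻¹ T Λ(c)⁻¹ with T again Toeplitz (T(b) is invertible as b₀ = 1, and
-- its inverse commutes with the shift), so an entry A⁻¹(x,z) is a product of
-- a factor depending on x, one depending on z and one depending on x − z.
-- Each side of an SDR identity is a product of entries whose rows, columns
-- and diagonals x − z run through the same multisets, hence the two sides
-- agree.
module Submission where

open import Defs
open import Level using (Level)
open import Algebra.Bundles using (CommutativeMonoid; Ring)
open import Relation.Binary.Bundles using (Setoid)
open import Data.Nat using (ℕ; zero; suc; _+_; _∸_; _≤_; _<_; _≤ᵇ_; _≡ᵇ_; _≟_; z≤n; s≤s; s≤s⁻¹)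
open import Data.Nat.Properties
  using ( +-comm; +-assoc; +-suc; +-∸-assoc; ∸-+-assoc; m+n∸m≡n; m∸[m∸n]≡n; n∸n≡0
        ; ≤-trans; m≤n+m; n<1+n; m<n⇒m<1+n; m≤n⇒m<n∨m≡n; m≤n⇒∃[o]m+o≡n
        ; ≤⇒≤ᵇ; ≡ᵇ⇒≡; +-commutativeSemigroup)
open import Algebra.Properties.CommutativeSemigroup +-commutativeSemigroup
  using () renaming (x∙yz≈y∙xz to m+[n+o]≡n+[m+o])
open import Data.Bool using (true; false)
open import Data.Product using (_,_; proj₁; proj₂)
open import Data.Sum using (inj₁; inj₂)
open import Data.Empty using (⊥-elim)
open import Relation.Nullary using (¬_; Dec; yes; no)
import Relation.Binary.PropositionalEquality as ≡
open ≡ using (_≡_; _≢_)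

m∸1+[m∸1+n]≡n : ∀ {m n} → n < m → m ∸ suc (m ∸ suc n) ≡ n
m∸1+[m∸1+n]≡n (s≤s n≤m) = m∸[m∸n]≡n n≤m

+-∸-assoc₂ : ∀ m n {o i} → i ≤ o → m + (n + o) ∸ i ≡ m + (n + (o ∸ i))
+-∸-assoc₂ m n {o} i≤o =
  ≡.trans (+-∸-assoc m (≤-trans i≤o (m≤n+m o n))) (≡.cong (m +_) (+-∸-assoc n i≤o))

module RangeProduct {c ℓ : Level} (M : CommutativeMonoid c ℓ) where
  open CommutativeMonoid M
  open import Algebra.Properties.CommutativeSemigroup commutativeSemigroup using (interchange)
  open import Relation.Binary.Reasoning.Setoid setoid

  ∏ : ℕ → (ℕ → Carrier) → Carrier
  ∏ zero    f = ε
  ∏ (suc m) f = ∏ m f ∙ f m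

  ∏-cong : ∀ m {f g} → (∀ i → i < m → f i ≈ g i) → ∏ m f ≈ ∏ m g
  ∏-cong zero    f≈g = refl
  ∏-cong (suc m) f≈g =
    ∙-cong (∏-cong m (λ i i<m → f≈g i (m<n⇒m<1+n i<m))) (f≈g m (n<1+n m))

  ∏-sucˡ : ∀ m f → ∏ (suc m) f ≈ f 0 ∙ ∏ m (λ i → f (suc i))
  ∏-sucˡ zero    f = trans (identityˡ _) (sym (identityʳ _))
  ∏-sucˡ (suc m) f = trans (∙-congʳ (∏-sucˡ m f)) (assoc _ _ _)

  ∏-+ : ∀ m n f → ∏ (m + n) f ≈ ∏ m f ∙ ∏ n (λ i → f (m + i))
  ∏-+ zero    n f = sym (identityˡ _)
  ∏-+ (suc m) n f = begin
    ∏ (suc (m + n)) f                                      ≈⟨ ∏-sucˡ (m + n) f ⟩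
    f 0 ∙ ∏ (m + n) (λ i → f (suc i))                      ≈⟨ ∙-congˡ (∏-+ m n _) ⟩
    f 0 ∙ (∏ m (λ i → f (suc i)) ∙ ∏ n (λ i → f (suc m + i))) ≈⟨ assoc _ _ _ ⟨
    (f 0 ∙ ∏ m (λ i → f (suc i))) ∙ ∏ n (λ i → f (suc m + i)) ≈⟨ ∙-congʳ (∏-sucˡ m f) ⟨
    ∏ (suc m) f ∙ ∏ n (λ i → f (suc m + i))                ∎

  ∏-reverse : ∀ m f → ∏ m f ≈ ∏ m (λ i → f (m ∸ suc i))
  ∏-reverse zero    f = refl
  ∏-reverse (suc m) f = begin
    ∏ m f ∙ f m                     ≈⟨ ∙-congʳ (∏-reverse m f) ⟩
    ∏ m (λ i → f (m ∸ suc i)) ∙ f m ≈⟨ comm _ _ ⟩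
    f m ∙ ∏ m (λ i → f (m ∸ suc i)) ≈⟨ ∏-sucˡ m (λ i → f (m ∸ i)) ⟨
    ∏ (suc m) (λ i → f (m ∸ i))     ∎

  ∏-+-reverseˡ : ∀ m n f → ∏ m (λ i → f (m ∸ suc i)) ∙ ∏ n (λ i → f (m + i)) ≈ ∏ (m + n) f
  ∏-+-reverseˡ m n f = trans (∙-congʳ (sym (∏-reverse m f))) (sym (∏-+ m n f))

  ∏-+-reverseʳ : ∀ m n f → ∏ m f ∙ ∏ n (λ i → f (m + (n ∸ suc i))) ≈ ∏ (m + n) f
  ∏-+-reverseʳ m n f = trans (∙-congˡ (sym (∏-reverse n _))) (sym (∏-+ m n f))

  ∏-distrib : ∀ m f g → ∏ m (λ i → f i ∙ g i) ≈ ∏ m f ∙ ∏ m g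
  ∏-distrib zero    f g = sym (identityˡ ε)
  ∏-distrib (suc m) f g = trans (∙-congʳ (∏-distrib m f g)) (interchange _ _ _ _)

module Toeplitz {a ℓ : Level} (S : Setoid a ℓ) where
  open Setoid S

  IsToeplitz : (ℕ → ℕ → Carrier) → Set ℓ
  IsToeplitz T = ∀ x z → T (suc x) (suc z) ≈ T x z

  shift : ∀ {T} → IsToeplitz T → ∀ t x z → T (t + x) (t + z) ≈ T x z
  shift T-toeplitz zero    x z = refl
  shift T-toeplitz (suc t) x z = trans (T-toeplitz (t + x) (t + z)) (shift T-toeplitz t x z)

module Convolution {c ℓ : Level} (R : Ring c ℓ) where
  open Ring R renaming (_+_ to _⊕_)
  open RangeProduct +-commutativeMonoid public
    using () renaming (∏ to Σ; ∏-cong to Σ-cong; ∏-sucˡ to Σ-sucˡ)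
  open import Algebra.Properties.Group +-group using () renaming (∙-cancelˡ to +-cancelˡ)
  open import Relation.Binary.Reasoning.Setoid setoid

  *-distribˡ-Σ : ∀ x m f → x * Σ m f ≈ Σ m (λ i → x * f i)
  *-distribˡ-Σ x zero    f = zeroʳ x
  *-distribˡ-Σ x (suc m) f = trans (distribˡ x _ _) (+-congʳ (*-distribˡ-Σ x m f))

  _⋆_ : (ℕ → Carrier) → (ℕ → Carrier) → ℕ → Carrier
  (b ⋆ u) m = Σ (suc m) (λ j → b (m ∸ j) * u j)

  ⋆-suc : ∀ b u m → u 0 ≈ 0# → (b ⋆ u) (suc m) ≈ (b ⋆ (λ i → u (suc i))) m
  ⋆-suc b u m u₀≈0 = begin
    (b ⋆ u) (suc m)                                  ≈⟨ Σ-sucˡ (suc m) _ ⟩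
    b (suc m) * u 0 ⊕ (b ⋆ (λ i → u (suc i))) m      ≈⟨ +-congʳ (trans (*-congˡ u₀≈0) (zeroʳ _)) ⟩
    0# ⊕ (b ⋆ (λ i → u (suc i))) m                   ≈⟨ +-identityˡ _ ⟩
    (b ⋆ (λ i → u (suc i))) m                        ∎

  ⋆-cancelˡ : ∀ {b u v} → b 0 ≈ 1# → (∀ m → (b ⋆ u) m ≈ (b ⋆ v) m) → ∀ j → u j ≈ v j
  ⋆-cancelˡ {b} {u} {v} b₀≈1 b⋆u≈b⋆v j = agreeBelow (suc j) j (n<1+n j)
    where
    agreeBelow : ∀ m j → j < m → u j ≈ v j
    agreeBelow (suc m) j j<1+m with m≤n⇒m<n∨m≡n (s≤s⁻¹ j<1+m)
    ... | inj₁ j<m     = agreeBelow m j j<m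
    ... | inj₂ ≡.refl = begin
      u j                ≈⟨ *-identityˡ (u j) ⟨
      1# * u j           ≈⟨ *-congʳ b[j∸j]≈1 ⟨
      b (j ∸ j) * u j    ≈⟨ +-cancelˡ _ _ _ leading ⟩
      b (j ∸ j) * v j    ≈⟨ *-congʳ b[j∸j]≈1 ⟩
      1# * v j           ≈⟨ *-identityˡ (v j) ⟩
      v j                ∎
      where
      b[j∸j]≈1 : b (j ∸ j) ≈ 1#
      b[j∸j]≈1 = trans (reflexive (≡.cong b (n∸n≡0 j))) b₀≈1
      leading : Σ j (λ i → b (j ∸ i) * v i) ⊕ b (j ∸ j) * u j
              ≈ Σ j (λ i → b (j ∸ i) * v i) ⊕ b (j ∸ j) * v j
      leading = trans (+-congʳ (sym (Σ-cong j (λ i i<j → *-congˡ (agreeBelow j i i<j)))))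
                      (b⋆u≈b⋆v j)

module ScaledToeplitz {ℓ₁ ℓ₂ : Level} (F : Field ℓ₁ ℓ₂) where
  open Field F hiding (+-comm; +-assoc) renaming (_+_ to _⊕_)
  open RangeProduct *-commutativeMonoid
  open Toeplitz setoid
  open import Algebra.Properties.CommutativeSemigroup *-commutativeSemigroup using (interchange)
  open import Relation.Binary.Reasoning.Setoid setoid

  prodUpTo≡∏ : ∀ m f → prodUpTo F m f ≡ ∏ m f
  prodUpTo≡∏ zero    f = ≡.refl
  prodUpTo≡∏ (suc m) f = ≡.cong (_* f m) (prodUpTo≡∏ m f)

  module _ {α β : ℕ → Carrier} {T M : Matrix F} (T-toeplitz : IsToeplitz T)
           (M≈αβT : ∀ x z → M x z ≈ α x * β z * T x z) where

    M-cong : ∀ {x x′ z z′} → x ≡ x′ → z ≡ z′ → M x z ≈ M x′ z′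
    M-cong x≡x′ z≡z′ = reflexive (≡.cong₂ M x≡x′ z≡z′)

    ∏-factor : ∀ m (R C : ℕ → ℕ) →
      ∏ m (λ i → M (R i) (C i))
        ≈ ∏ m (λ i → α (R i)) * ∏ m (λ i → β (C i)) * ∏ m (λ i → T (R i) (C i))
    ∏-factor m R C =
      trans (∏-cong m (λ i _ → M≈αβT (R i) (C i)))
            (trans (∏-distrib m _ _) (*-congʳ (∏-distrib m _ _)))

    module _ (n k : ℕ) where

      -- With u = r + 1 and v = p − r, the left side of the SDR identity at
      -- (n, k, p, r) is sdrProduct u v and its right side, with the two factors
      -- swapped, is sdrProduct v u.
      sdrProduct : ℕ → ℕ → Carrier
      sdrProduct u v = ∏ u (λ i → M (n + i) (k + (u ∸ suc i)))
                     * ∏ v (λ i → M (n + (u + (v ∸ suc i))) (k + (u + i)))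

      antidiagonal : ℕ → Carrier
      antidiagonal u = ∏ u (λ i → T (n + i) (k + (u ∸ suc i)))

      shifted-antidiagonal : ∀ u v →
        ∏ v (λ i → T (n + (u + (v ∸ suc i))) (k + (u + i))) ≈ antidiagonal v
      shifted-antidiagonal u v = begin
        ∏ v (λ i → T (n + (u + (v ∸ suc i))) (k + (u + i)))
          ≈⟨ ∏-cong v (λ i _ → trans (reflexive (≡.cong₂ T (m+[n+o]≡n+[m+o] n u _) (m+[n+o]≡n+[m+o] k u i)))
                                     (shift T-toeplitz u _ _)) ⟩
        ∏ v (λ i → T (n + (v ∸ suc i)) (k + i))
          ≈⟨ ∏-cong v (λ i i<v → reflexive (≡.cong (λ j → T (n + (v ∸ suc i)) (k + j)) (≡.sym (m∸1+[m∸1+n]≡n i<v)))) ⟩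
        ∏ v (λ i → T (n + (v ∸ suc i)) (k + (v ∸ suc (v ∸ suc i))))
          ≈⟨ ∏-reverse v _ ⟨
        antidiagonal v ∎

      sdrProduct-factorise : ∀ u v → sdrProduct u v
        ≈ ∏ (u + v) (λ i → α (n + i)) * ∏ (u + v) (λ i → β (k + i)) * (antidiagonal u * antidiagonal v)
      sdrProduct-factorise u v =
        trans (*-cong (∏-factor u _ _) (∏-factor v _ _))
        (trans (trans (interchange _ _ _ _) (*-congʳ (interchange _ _ _ _)))
               (*-cong (*-cong (∏-+-reverseʳ u v _) (∏-+-reverseˡ u v _))
                       (*-congˡ (shifted-antidiagonal u v))))

      sdrProduct-comm : ∀ u v → sdrProduct u v ≈ sdrProduct v u
      sdrProduct-comm u v = begin
        sdrProduct u v
          ≈⟨ sdrProduct-factorise u v ⟩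
        ∏ (u + v) (λ i → α (n + i)) * ∏ (u + v) (λ i → β (k + i)) * (antidiagonal u * antidiagonal v)
          ≈⟨ *-cong (reflexive (≡.cong (λ m → ∏ m (λ i → α (n + i)) * ∏ m (λ i → β (k + i))) (+-comm u v)))
                    (*-comm _ _) ⟩
        ∏ (v + u) (λ i → α (n + i)) * ∏ (v + u) (λ i → β (k + i)) * (antidiagonal v * antidiagonal u)
          ≈⟨ sdrProduct-factorise v u ⟨
        sdrProduct v u ∎

      sdr-lhs : ∀ r s →
        prodUpTo F (suc r) (λ i → M (n + i) (k + r ∸ i))
          * prodUpTo F (suc s) (λ i → M (n + suc (r + s) ∸ i) (k + r + i + 1))
        ≈ sdrProduct (suc r) (suc s)
      sdr-lhs r s =
        trans (reflexive (≡.cong₂ _*_ (prodUpTo≡∏ (suc r) _) (prodUpTo≡∏ (suc s) _)))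
              (*-cong (∏-cong (suc r) (λ i i<1+r → M-cong ≡.refl (+-∸-assoc k (s≤s⁻¹ i<1+r))))
                      (∏-cong (suc s) (λ i i<1+s → M-cong (+-∸-assoc₂ n (suc r) (s≤s⁻¹ i<1+s))
                                                          (k+r+i+1≡k+[1+r+i] i))))
        where
        k+r+i+1≡k+[1+r+i] : ∀ i → k + r + i + 1 ≡ k + (suc r + i)
        k+r+i+1≡k+[1+r+i] i =
          ≡.trans (+-comm _ 1) (≡.trans (≡.cong suc (+-assoc k r i)) (≡.sym (+-suc k (r + i))))

      sdr-rhs : ∀ r s →
        prodUpTo F (suc r) (λ i → M (n + suc (r + s) ∸ i) (k + suc s + i))
          * prodUpTo F (suc s) (λ i → M (n + i) (k + suc s ∸ i ∸ 1))
        ≈ sdrProduct (suc s) (suc r)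
      sdr-rhs r s =
        trans (reflexive (≡.cong₂ _*_ (prodUpTo≡∏ (suc r) _) (prodUpTo≡∏ (suc s) _)))
        (trans (*-comm _ _)
               (*-cong (∏-cong (suc s) (λ i i<1+s → M-cong ≡.refl (k+1+s∸i∸1≡k+[s∸i] (s≤s⁻¹ i<1+s))))
                       (∏-cong (suc r) (λ i i<1+r → M-cong (n+1+[r+s]∸i≡n+[1+s+[r∸i]] (s≤s⁻¹ i<1+r))
                                                           (+-assoc k (suc s) i)))))
        where
        n+1+[r+s]∸i≡n+[1+s+[r∸i]] : ∀ {i} → i ≤ r → n + suc (r + s) ∸ i ≡ n + (suc s + (r ∸ i))
        n+1+[r+s]∸i≡n+[1+s+[r∸i]] {i} i≤r =
          ≡.trans (≡.cong (λ t → n + suc t ∸ i) (+-comm r s)) (+-∸-assoc₂ n (suc s) i≤r)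
        k+1+s∸i∸1≡k+[s∸i] : ∀ {i} → i ≤ s → k + suc s ∸ i ∸ 1 ≡ k + (s ∸ i)
        k+1+s∸i∸1≡k+[s∸i] {i} i≤s =
          ≡.trans (∸-+-assoc (k + suc s) i 1)
          (≡.trans (≡.cong (k + suc s ∸_) (+-comm i 1)) (+-∸-assoc k (s≤s i≤s)))

    scaledToeplitz⇒SDR∞ : SDR∞ F M
    scaledToeplitz⇒SDR∞ _ _ n k (suc p) r (s≤s _) _ r≤p with m≤n⇒∃[o]m+o≡n r≤p
    ... | s , ≡.refl rewrite ≡.trans (≡.cong (_∸ r) (≡.sym (+-suc r s))) (m+n∸m≡n r (suc s)) =
      trans (sdr-lhs n k r s) (trans (sdrProduct-comm n k (suc r) (suc s)) (sym (sdr-rhs n k r s)))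

module AbcInverse {ℓ₁ ℓ₂ : Level} (F : Field ℓ₁ ℓ₂) where
  open Field F renaming (_+_ to _⊕_)
  open Convolution ring
  open Toeplitz setoid
  import Algebra.Solver.CommutativeMonoid *-commutativeMonoid as Solver
  open Solver using (solve; _⊜_) renaming (_⊕_ to _⊗_)
  open import Relation.Binary.Reasoning.Setoid setoid

  sumUpTo≡Σ : ∀ m f → sumUpTo F m f ≡ Σ m f
  sumUpTo≡Σ zero    f = ≡.refl
  sumUpTo≡Σ (suc m) f = ≡.cong (_⊕ f m) (sumUpTo≡Σ m f)

  identity-offDiagonal : ∀ {n z} → n ≢ z → identityMatrix F n z ≈ 0#
  identity-offDiagonal {n} {z} n≢z with n ≡ᵇ z | ≡ᵇ⇒≡ n z
  ... | true  | n≡z = ⊥-elim (n≢z (n≡z _))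
  ... | false | _   = refl

  x*y≈0⇒y≈0 : ∀ {x y} → ¬ x ≈ 0# → x * y ≈ 0# → y ≈ 0#
  x*y≈0⇒y≈0 {x} {y} x≉0 xy≈0 with inverse x x≉0
  ... | x⁻¹ , xx⁻¹≈1 = begin
    y               ≈⟨ *-identityˡ y ⟨
    1# * y          ≈⟨ *-congʳ (trans (*-comm x⁻¹ x) xx⁻¹≈1) ⟨
    (x⁻¹ * x) * y   ≈⟨ *-assoc x⁻¹ x y ⟩
    x⁻¹ * (x * y)   ≈⟨ *-congˡ xy≈0 ⟩
    x⁻¹ * 0#        ≈⟨ zeroʳ x⁻¹ ⟩
    0#              ∎

  module _ (a b c : ℕ → Carrier) (b₀≈1 : b 0 ≈ 1#)
           (a≉0 : ∀ n → ¬ a n ≈ 0#) (c≉0 : ∀ n → ¬ c n ≈ 0#)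
           (Ainv : Matrix F) (inv : IsInverseLT F (abcMatrix F a b c) Ainv) where

    a⁻¹ c⁻¹ : ℕ → Carrier
    a⁻¹ n = proj₁ (inverse (a n) (a≉0 n))
    c⁻¹ n = proj₁ (inverse (c n) (c≉0 n))

    toeplitzPart : Matrix F
    toeplitzPart x z = a x * Ainv x z * c z

    Ainv-factorise : ∀ x z → Ainv x z ≈ a⁻¹ x * c⁻¹ z * toeplitzPart x z
    Ainv-factorise x z = sym (begin
      a⁻¹ x * c⁻¹ z * (a x * Ainv x z * c z)
        ≈⟨ solve 5 (λ a′ c′ α μ γ → ((a′ ⊗ c′) ⊗ ((α ⊗ μ) ⊗ γ)) ⊜ (((α ⊗ a′) ⊗ (γ ⊗ c′)) ⊗ μ))
                   refl (a⁻¹ x) (c⁻¹ z) (a x) (Ainv x z) (c z) ⟩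
      (a x * a⁻¹ x) * (c z * c⁻¹ z) * Ainv x z
        ≈⟨ *-congʳ (*-cong (proj₂ (inverse (a x) (a≉0 x))) (proj₂ (inverse (c z) (c≉0 z)))) ⟩
      1# * 1# * Ainv x z
        ≈⟨ trans (*-congʳ (*-identityˡ 1#)) (*-identityˡ _) ⟩
      Ainv x z ∎)

    abc-entry : ∀ {n j} → j ≤ n → abcMatrix F a b c n j ≈ a j * b (n ∸ j) * c n
    abc-entry {n} {j} j≤n with j ≤ᵇ n | ≤⇒≤ᵇ j≤n
    ... | true | _ = refl

    c*[b⋆aAinv]≈δ : ∀ n z → c n * (b ⋆ (λ j → a j * Ainv j z)) n ≈ identityMatrix F n z
    c*[b⋆aAinv]≈δ n z = begin
      c n * (b ⋆ (λ j → a j * Ainv j z)) n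
        ≈⟨ *-distribˡ-Σ (c n) (suc n) _ ⟩
      Σ (suc n) (λ j → c n * (b (n ∸ j) * (a j * Ainv j z)))
        ≈⟨ Σ-cong (suc n) (λ j j<1+n → trans (*-congʳ (abc-entry (s≤s⁻¹ j<1+n)))
                                              (rearrange (a j) (b (n ∸ j)) (c n) (Ainv j z))) ⟨
      Σ (suc n) (λ j → abcMatrix F a b c n j * Ainv j z)
        ≡⟨ sumUpTo≡Σ (suc n) _ ⟨
      mulLT F (abcMatrix F a b c) Ainv n z
        ≈⟨ proj₁ (proj₂ inv) n z ⟩
      identityMatrix F n z ∎
      where
      rearrange : ∀ α β γ μ → α * β * γ * μ ≈ γ * (β * (α * μ))
      rearrange = solve 4 (λ α β γ μ → (((α ⊗ β) ⊗ γ) ⊗ μ) ⊜ (γ ⊗ (β ⊗ (α ⊗ μ)))) refl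

    b⋆column≈δ : ∀ z n → (b ⋆ (λ x → toeplitzPart x z)) n ≈ identityMatrix F n z
    b⋆column≈δ z n = trans column≈c*[b⋆aAinv] (c-transfer (n ≟ z))
      where
      column≈c*[b⋆aAinv] : (b ⋆ (λ x → toeplitzPart x z)) n ≈ c z * (b ⋆ (λ j → a j * Ainv j z)) n
      column≈c*[b⋆aAinv] =
        trans (Σ-cong (suc n) (λ j _ → solve 4 (λ β α μ γ → (β ⊗ ((α ⊗ μ) ⊗ γ)) ⊜ (γ ⊗ (β ⊗ (α ⊗ μ))))
                                              refl (b (n ∸ j)) (a j) (Ainv j z) (c z)))
              (sym (*-distribˡ-Σ (c z) (suc n) _))
      -- Off the diagonal the sum itself vanishes, as c n ≠ 0.
      c-transfer : Dec (n ≡ z) → c z * (b ⋆ (λ j → a j * Ainv j z)) n ≈ identityMatrix F n z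
      c-transfer (yes ≡.refl) = c*[b⋆aAinv]≈δ n n
      c-transfer (no n≢z) = begin
        c z * _ ≈⟨ *-congˡ (x*y≈0⇒y≈0 (c≉0 n) (trans (c*[b⋆aAinv]≈δ n z) (identity-offDiagonal n≢z))) ⟩
        c z * 0# ≈⟨ zeroʳ (c z) ⟩
        0# ≈⟨ identity-offDiagonal n≢z ⟨
        identityMatrix F n z ∎

    toeplitzPart-toeplitz : IsToeplitz toeplitzPart
    toeplitzPart-toeplitz x z = ⋆-cancelˡ {b} b₀≈1 shifted-column x
      where
      top-entry≈0 : toeplitzPart 0 (suc z) ≈ 0#
      top-entry≈0 = trans (*-congʳ (trans (*-congˡ (proj₁ inv 0 (suc z) (s≤s z≤n))) (zeroʳ (a 0))))
                          (zeroˡ (c (suc z)))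
      shifted-column : ∀ m → (b ⋆ (λ x → toeplitzPart (suc x) (suc z))) m
                           ≈ (b ⋆ (λ x → toeplitzPart x z)) m
      shifted-column m = begin
        (b ⋆ (λ x → toeplitzPart (suc x) (suc z))) m   ≈⟨ ⋆-suc b _ m top-entry≈0 ⟨
        (b ⋆ (λ x → toeplitzPart x (suc z))) (suc m)   ≈⟨ b⋆column≈δ (suc z) (suc m) ⟩
        identityMatrix F m z                           ≈⟨ b⋆column≈δ z m ⟨
        (b ⋆ (λ x → toeplitzPart x z)) m               ∎

theorem2p1 : ∀ {c ℓ : Level} (F : Field c ℓ) →
    let open Field F in
    (a b c : ℕ → Carrier) →
    b 0 ≈ 1# →
    (∀ n → ¬ (a n ≈ 0#)) →
    (∀ n → ¬ (c n ≈ 0#)) →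
    (Ainv : Matrix F) →
    IsInverseLT F (abcMatrix F a b c) Ainv →
    SDR∞ F Ainv
theorem2p1 F a b c b₀≈1 a≉0 c≉0 Ainv inv =
  scaledToeplitz⇒SDR∞ (toeplitzPart-toeplitz a b c b₀≈1 a≉0 c≉0 Ainv inv)
                      (Ainv-factorise a b c b₀≈1 a≉0 c≉0 Ainv inv)
  where
  open ScaledToeplitz F
  open AbcInverse F
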